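{- Let $G$ be a connected cograph on $n$ vertices. Then either $G$ has a cut-vertex and $meg(G)=n-1$, or else $meg(G)=n$.
   Context: All graphs are finite and simple. A cograph is a graph with no induced path on $4$ vertices. A pair of vertices $u,v$ (or any vertex set containing them) monitors an edge $e$ if $e$ lies on every shortest $u$–$v$ path. A monitoring edge-geodetic set (MEG-set) of $G$ is a set $M\subseteq V(G)$ such that every edge of $G$ is monitored by some pair of vertices of $M$; $meg(G)$ is the minimum size of an MEG-set. -}

module Defs where

open import Data.Nat using (ℕ; zero; suc; _≤_)
open import Data.Bool using (Bool; true; false; _∧_; not)
open import Data.Fin using (Fin)
open import Data.Fin.Properties using (_≟_)
open import Data.Fin.Subset using (Subset; _∈_; ∣_∣)
open import Data.Product using (Σ; ∃; _×_; _,_)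
open import Data.Sum using (_⊎_)
open import Relation.Nullary using (¬_)
open import Relation.Nullary.Decidable using (⌊_⌋)
open import Relation.Binary.PropositionalEquality using (_≡_; _≢_)

record Graph (n : ℕ) : Set where
  field
    adj    : Fin n → Fin n → Bool
    sym    : ∀ u v → adj u v ≡ adj v u
    irrefl : ∀ u → adj u u ≡ false
open Graph public

Adj : ∀ {n} → Graph n → Fin n → Fin n → Set
Adj G u v = adj G u v ≡ true

data Walk {n : ℕ} (G : Graph n) : Fin n → Fin n → ℕ → Set where
  here : ∀ {u} → Walk G u u 0
  step : ∀ {u w v k} → Adj G u w → Walk G w v k → Walk G u v (suc k)

module _ {n : ℕ} (G : Graph n) where

  EdgeOn : ∀ {u v k} → Walk G u v k → Fin n → Fin n → Set
  EdgeOn here x y = Data.Empty.⊥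
    where import Data.Empty
  EdgeOn (step {u} {w} _ p) x y =
    ((u ≡ x × w ≡ y) ⊎ (u ≡ y × w ≡ x)) ⊎ EdgeOn p x y

  IsShortest : ∀ {u v k} → Walk G u v k → Set
  IsShortest {u} {v} {k} _ = ∀ {m} → Walk G u v m → k ≤ m

  Monitors : Fin n → Fin n → Fin n → Fin n → Set
  Monitors u v x y = ∀ {k} (p : Walk G u v k) → IsShortest p → EdgeOn p x y

  IsMEG : Subset n → Set
  IsMEG M = ∀ x y → Adj G x y →
    Σ (Fin n) λ u → Σ (Fin n) λ v → u ∈ M × v ∈ M × Monitors u v x y

  MegIs : ℕ → Set
  MegIs m = (Σ (Subset n) λ M → IsMEG M × ∣ M ∣ ≡ m)
          × (∀ M → IsMEG M → m ≤ ∣ M ∣)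

  Connected : Set
  Connected = ∀ u v → ∃ λ k → Walk G u v k

  HasInducedP4 : Set
  HasInducedP4 = Σ (Fin n) λ a → Σ (Fin n) λ b → Σ (Fin n) λ c → Σ (Fin n) λ d →
    (a ≢ b × a ≢ c × a ≢ d × b ≢ c × b ≢ d × c ≢ d)
    × (Adj G a b × Adj G b c × Adj G c d)
    × (¬ Adj G a c × ¬ Adj G a d × ¬ Adj G b d)

  IsCograph : Set
  IsCograph = ¬ HasInducedP4

  -- G - w, kept on the same vertex set with w made isolated
  deleteVertex : Fin n → Graph n
  deleteVertex w = record
    { adj    = λ u v → adj G u v ∧ not ⌊ u ≟ w ⌋ ∧ not ⌊ v ≟ w ⌋
    ; sym    = symm
    ; irrefl = λ u → irr u
    }
    where
      open import Data.Bool.Properties using (∧-comm; ∧-assoc)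
      open import Relation.Binary.PropositionalEquality using (cong₂; trans; cong)
      symm : ∀ u v → (adj G u v ∧ not ⌊ u ≟ w ⌋ ∧ not ⌊ v ≟ w ⌋)
                   ≡ (adj G v u ∧ not ⌊ v ≟ w ⌋ ∧ not ⌊ u ≟ w ⌋)
      symm u v rewrite Graph.sym G u v = cong (adj G v u ∧_) (∧-comm (not ⌊ u ≟ w ⌋) _)
      irr : ∀ u → (adj G u u ∧ not ⌊ u ≟ w ⌋ ∧ not ⌊ u ≟ w ⌋) ≡ false
      irr u rewrite Graph.irrefl G u = Relation.Binary.PropositionalEquality.refl

  -- w is a cut-vertex: some two vertices other than w that are connected in G
  -- are no longer connected in G - w (the number of components increases)
  IsCutVertex : Fin n → Set
  IsCutVertex w = Σ (Fin n) λ a → Σ (Fin n) λ b →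
    a ≢ w × b ≢ w × (∃ λ k → Walk G a b k)
    × ¬ (∃ λ k → Walk (deleteVertex w) a b k)

  HasCutVertex : Set
  HasCutVertex = Σ (Fin n) IsCutVertex

{-# OPTIONS --safe #-}
-- In a connected cograph every walk shortcuts to length at most 2.  Hence the pair monitoring
-- an edge at a vertex v outside an MEG-set is a non-adjacent pair a, b whose only common
-- neighbour is v.  Such a v is a cut-vertex (G - v is again a cograph, so a path from a to b
-- avoiding v would shortcut to one of length at most 2), and it is adjacent to every other
-- vertex (otherwise an induced P4 appears), so it is the only vertex of this kind.  Conversely,
-- every neighbour y of such a v pairs with a or b to a pair whose only common neighbour is v,
-- so V ∖ {v} is an MEG-set.
module Submission where

open import Defs hiding (sym)
open import Data.Bool using (true)
import Data.Bool as Bool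
open import Data.Empty using (⊥-elim)
open import Data.Fin using (Fin; zero; suc)
open import Data.Fin.Properties using (_≟_; any?; all?)
open import Data.Fin.Subset using (Subset; _∈_; _∉_; _⊆_; ∣_∣; ∁; ⁅_⁆) renaming (⊥ to ∅)
open import Data.Fin.Subset.Properties
  using (_∈?_; ∉⊥; ∣⊥∣≡0; x∈⁅x⁆; x≢y⇒x∉⁅y⁆; x∈∁p⇒x∉p; x∉p⇒x∈∁p; ∣⁅x⁆∣≡1; ∣∁p∣≡n∸∣p∣; p⊆q⇒∣p∣≤∣q∣)
open import Data.Nat using (ℕ; suc; _≤_; _∸_; z≤n; s≤s)
open import Data.Product using (_×_; ∃; ∃₂; _,_; proj₁; proj₂)
import Data.Product as Product
open import Data.Sum using (_⊎_; inj₁; inj₂; [_,_]′)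
open import Function using (_∘_)
open import Relation.Nullary using (¬_; Dec; yes; no)
open import Relation.Nullary.Decidable using (map′; ¬?; _×-dec_; _→-dec_; decidable-stable)
open import Relation.Binary.PropositionalEquality
  using (_≡_; _≢_; refl; sym; trans; subst; cong; ≢-sym)

∃-other : ∀ {n} → 2 ≤ n → (v : Fin n) → ∃ λ x → x ≢ v
∃-other (s≤s (s≤s _)) zero    = suc zero , λ ()
∃-other (s≤s (s≤s _)) (suc v) = zero , λ ()

∈∧∉⇒≢ : ∀ {n} {p : Subset n} {x y} → x ∈ p → y ∉ p → x ≢ y
∈∧∉⇒≢ x∈p y∉p refl = y∉p x∈p

x≢y⇒x∈∁⁅y⁆ : ∀ {n} {x y : Fin n} → x ≢ y → x ∈ ∁ ⁅ y ⁆
x≢y⇒x∈∁⁅y⁆ = x∉p⇒x∈∁p ∘ x≢y⇒x∉⁅y⁆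

∁q⊆p⇒∁p⊆q : ∀ {n} {p q : Subset n} → ∁ q ⊆ p → ∁ p ⊆ q
∁q⊆p⇒∁p⊆q {q = q} ∁q⊆p {x} x∈∁p =
  decidable-stable (x ∈? q) (λ x∉q → x∈∁p⇒x∉p x∈∁p (∁q⊆p (x∉p⇒x∈∁p x∉q)))

Reachable : ∀ {n} → Graph n → Fin n → Fin n → Set
Reachable G u v = ∃ λ k → Walk G u v k

reachable-trans : ∀ {n} {G : Graph n} {u v w} → Reachable G u v → Reachable G v w → Reachable G u w
reachable-trans (_ , here)     q = q
reachable-trans (_ , step e p) q = Product.map suc (step e) (reachable-trans (_ , p) q)

data Dist≤2 {n} (G : Graph n) (u v : Fin n) : Set where
  same     : u ≡ v → Dist≤2 G u v
  adjacent : Adj G u v → Dist≤2 G u v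
  via      : ∀ w → Adj G u w → Adj G w v → Dist≤2 G u v

module GraphBasics {n : ℕ} (G : Graph n) where

  adj? : ∀ u v → Dec (Adj G u v)
  adj? u v = adj G u v Bool.≟ true

  adj-sym : ∀ {u v} → Adj G u v → Adj G v u
  adj-sym {u} {v} = trans (Graph.sym G v u)

  adj⇒≢ : ∀ {u v} → Adj G u v → u ≢ v
  adj⇒≢ {u} u∼u refl with () ← trans (sym (irrefl G u)) u∼u

  inducedP4 : ∀ {a b c d} → Adj G a b → Adj G b c → Adj G c d →
              ¬ Adj G a c → ¬ Adj G a d → ¬ Adj G b d → a ≢ c → b ≢ d → HasInducedP4 G
  inducedP4 {a} {b} {c} {d} a∼b b∼c c∼d a≁c a≁d b≁d a≢c b≢d =
    a , b , c , d , (adj⇒≢ a∼b , a≢c , a≢d , adj⇒≢ b∼c , b≢d , adj⇒≢ c∼d) ,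
    (a∼b , b∼c , c∼d) , (a≁c , a≁d , b≁d)
    where
      a≢d : a ≢ d
      a≢d refl = a≁c (adj-sym c∼d)

  walk⇒neighbour : ∀ {u v k} → Walk G u v k → u ≢ v → ∃ (Adj G u)
  walk⇒neighbour here       u≢u = ⊥-elim (u≢u refl)
  walk⇒neighbour (step e _) _   = _ , e

  ≢⇒1≤length : ∀ {u v k} → u ≢ v → Walk G u v k → 1 ≤ k
  ≢⇒1≤length u≢u here       = ⊥-elim (u≢u refl)
  ≢⇒1≤length _   (step _ _) = s≤s z≤n

  ≢∧≁⇒2≤length : ∀ {u v k} → u ≢ v → ¬ Adj G u v → Walk G u v k → 2 ≤ k
  ≢∧≁⇒2≤length u≢u _   here                = ⊥-elim (u≢u refl)
  ≢∧≁⇒2≤length _   u≁v (step u∼v here)     = ⊥-elim (u≁v u∼v)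
  ≢∧≁⇒2≤length _   _   (step _ (step _ _)) = s≤s (s≤s z≤n)

  module _ (cograph : IsCograph G) where

    -- Unless one of the shortcuts exists, u–w–x–v is an induced P4.
    path3⇒dist≤2 : ∀ {u w x v} → Adj G u w → Adj G w x → Adj G x v → Dist≤2 G u v
    path3⇒dist≤2 {u} {w} {x} {v} u∼w w∼x x∼v with u ≟ x | u ≟ v | w ≟ v
    ... | yes refl | _        | _        = adjacent x∼v
    ... | no _     | yes u≡v  | _        = same u≡v
    ... | no _     | no _     | yes refl = adjacent u∼w
    ... | no u≢x   | no u≢v   | no w≢v with adj? u x | adj? w v | adj? u v
    ...   | yes u∼x | _       | _       = via x u∼x x∼v
    ...   | no _    | yes w∼v | _       = via w u∼w w∼v
    ...   | no _    | no _    | yes u∼v = adjacent u∼v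
    ...   | no u≁x  | no w≁v  | no u≁v  =
      ⊥-elim (cograph (inducedP4 u∼w w∼x x∼v u≁x u≁v w≁v u≢x w≢v))

    walk⇒dist≤2 : ∀ {u v k} → Walk G u v k → Dist≤2 G u v
    walk⇒dist≤2 here = same refl
    walk⇒dist≤2 (step {w = w} u∼w p) with walk⇒dist≤2 p
    ... | same refl       = adjacent u∼w
    ... | adjacent w∼v    = via w u∼w w∼v
    ... | via x w∼x x∼v   = path3⇒dist≤2 u∼w w∼x x∼v

module Monitoring {n : ℕ} (G : Graph n) where
  open GraphBasics G

  adjacent-monitors : ∀ {x y} → Adj G x y → Monitors G x y x y
  adjacent-monitors x∼y here                _        = adj⇒≢ x∼y refl
  adjacent-monitors x∼y (step _ here)       _        = inj₁ (inj₁ (refl , refl))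
  adjacent-monitors x∼y (step _ (step _ _)) shortest with shortest (step x∼y here)
  ... | s≤s ()

  monitors⇒≢ : ∀ {a b x y} → Monitors G a b x y → a ≢ b
  monitors⇒≢ mon refl = mon here (λ _ → z≤n)

  monitors-adjacent⇒endpoint : ∀ {a b x y} → Monitors G a b x y → Adj G a b → a ≡ x ⊎ b ≡ x
  monitors-adjacent⇒endpoint mon a∼b with mon (step a∼b here) (≢⇒1≤length (adj⇒≢ a∼b))
  ... | inj₁ (inj₁ (a≡x , _)) = inj₁ a≡x
  ... | inj₁ (inj₂ (_ , b≡x)) = inj₂ b≡x

  monitors-path2⇒middle : ∀ {a b x y w} → Monitors G a b x y → ¬ Adj G a b → a ≢ x → b ≢ x →
                          Adj G a w → Adj G w b → w ≡ x
  monitors-path2⇒middle mon a≁b a≢x b≢x a∼w w∼b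
    with mon (step a∼w (step w∼b here)) (≢∧≁⇒2≤length (monitors⇒≢ mon) a≁b)
  ... | inj₁ (inj₁ (a≡x , _))          = ⊥-elim (a≢x a≡x)
  ... | inj₁ (inj₂ (_ , w≡x))          = w≡x
  ... | inj₂ (inj₁ (inj₁ (w≡x , _)))   = w≡x
  ... | inj₂ (inj₁ (inj₂ (_ , b≡x)))   = ⊥-elim (b≢x b≡x)

  record UniqueMidpoint (c a b : Fin n) : Set where
    constructor uniqueMidpoint
    field
      distinct    : a ≢ b
      nonadjacent : ¬ Adj G a b
      edgeˡ       : Adj G a c
      edgeʳ       : Adj G c b
      unique      : ∀ w → Adj G a w → Adj G w b → w ≡ c
  open UniqueMidpoint public

  IsUniqueMidpoint : Fin n → Set
  IsUniqueMidpoint c = ∃₂ (UniqueMidpoint c)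

  uniqueMidpoint? : ∀ c a b → Dec (UniqueMidpoint c a b)
  uniqueMidpoint? c a b =
    map′ (λ (d , n , l , r , u) → uniqueMidpoint d n l r u)
         (λ m → distinct m , nonadjacent m , edgeˡ m , edgeʳ m , unique m)
         (¬? (a ≟ b) ×-dec ¬? (adj? a b) ×-dec adj? a c ×-dec adj? c b ×-dec
          all? λ w → adj? a w →-dec (adj? w b →-dec (w ≟ c)))

  uniqueMidpoint-sym : ∀ {c a b} → UniqueMidpoint c a b → UniqueMidpoint c b a
  uniqueMidpoint-sym (uniqueMidpoint a≢b a≁b a∼c c∼b unique) =
    uniqueMidpoint (≢-sym a≢b) (a≁b ∘ adj-sym) (adj-sym c∼b) (adj-sym a∼c)
                   (λ w b∼w w∼a → unique w (adj-sym w∼a) (adj-sym b∼w))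

  uniqueMidpoint-on-shortest : ∀ {c a b k} → UniqueMidpoint c a b → (p : Walk G a b k) →
                               IsShortest G p → EdgeOn G p a c × EdgeOn G p c b
  uniqueMidpoint-on-shortest m here _ = ⊥-elim (distinct m refl)
  uniqueMidpoint-on-shortest m (step a∼b here) _ = ⊥-elim (nonadjacent m a∼b)
  uniqueMidpoint-on-shortest m (step {w = w} a∼w (step w∼b here)) _ with unique m w a∼w w∼b
  ... | refl = inj₁ (inj₁ (refl , refl)) , inj₂ (inj₁ (inj₁ (refl , refl)))
  uniqueMidpoint-on-shortest m (step _ (step _ (step _ _))) shortest
    with shortest (step (edgeˡ m) (step (edgeʳ m) here))
  ... | s≤s (s≤s ())

  uniqueMidpoint-monitorsˡ : ∀ {c a b} → UniqueMidpoint c a b → Monitors G a b a c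
  uniqueMidpoint-monitorsˡ m p shortest = proj₁ (uniqueMidpoint-on-shortest m p shortest)

  uniqueMidpoint-monitorsʳ : ∀ {c a b} → UniqueMidpoint c a b → Monitors G a b c b
  uniqueMidpoint-monitorsʳ m p shortest = proj₂ (uniqueMidpoint-on-shortest m p shortest)

  universal⇒only-midpoint : ∀ {v u c d} → (∀ z → z ≢ v → Adj G z v) → UniqueMidpoint u c d → u ≡ v
  universal⇒only-midpoint {v} {c = c} {d} universal m with c ≟ v | d ≟ v
  ... | yes refl | _        = ⊥-elim (nonadjacent m (adj-sym (universal d (≢-sym (distinct m)))))
  ... | no _     | yes refl = ⊥-elim (nonadjacent m (universal c (distinct m)))
  ... | no c≢v   | no d≢v   = sym (unique m v (universal c c≢v) (adj-sym (universal d d≢v)))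

  ∁⁅v⁆-isMEG : ∀ {v} → (∀ {y} → Adj G v y → ∃ λ t → UniqueMidpoint v t y) → IsMEG G (∁ ⁅ v ⁆)
  ∁⁅v⁆-isMEG {v} partner x y x∼y with x ≟ v | y ≟ v
  ... | yes refl | yes refl = ⊥-elim (adj⇒≢ x∼y refl)
  ... | yes refl | no y≢v   = let (t , m) = partner x∼y in
    t , y , x≢y⇒x∈∁⁅y⁆ (adj⇒≢ (edgeˡ m)) , x≢y⇒x∈∁⁅y⁆ y≢v , uniqueMidpoint-monitorsʳ m
  ... | no x≢v   | yes refl = let (t , m) = partner (adj-sym x∼y) in
    x , t , x≢y⇒x∈∁⁅y⁆ x≢v , x≢y⇒x∈∁⁅y⁆ (adj⇒≢ (edgeˡ m)) ,
    uniqueMidpoint-monitorsˡ (uniqueMidpoint-sym m)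
  ... | no x≢v   | no y≢v   = x , y , x≢y⇒x∈∁⁅y⁆ x≢v , x≢y⇒x∈∁⁅y⁆ y≢v , adjacent-monitors x∼y

  ∁∅-isMEG : IsMEG G (∁ ∅)
  ∁∅-isMEG x y x∼y = x , y , x∉p⇒x∈∁p ∉⊥ , x∉p⇒x∈∁p ∉⊥ , adjacent-monitors x∼y

  -- The pair monitoring an edge at v avoids v, so with diameter 2 it is a
  -- distance-2 pair all of whose geodesics pass through v.
  ∉MEG⇒isUniqueMidpoint : (∀ u v → Dist≤2 G u v) → ∀ {M v x} → IsMEG G M → v ∉ M → Adj G v x →
                          IsUniqueMidpoint v
  ∉MEG⇒isUniqueMidpoint diameter≤2 {v = v} meg v∉M v∼x with meg _ _ v∼x
  ... | a , b , a∈M , b∈M , mon = a , b , midpoint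
    where
      a≢v = ∈∧∉⇒≢ a∈M v∉M
      b≢v = ∈∧∉⇒≢ b∈M v∉M
      a≁b : ¬ Adj G a b
      a≁b = [ a≢v , b≢v ]′ ∘ monitors-adjacent⇒endpoint mon
      middle : ∀ w → Adj G a w → Adj G w b → w ≡ v
      middle w = monitors-path2⇒middle mon a≁b a≢v b≢v
      midpoint : UniqueMidpoint v a b
      midpoint with diameter≤2 a b
      ... | same a≡b     = ⊥-elim (monitors⇒≢ mon a≡b)
      ... | adjacent a∼b = ⊥-elim (a≁b a∼b)
      ... | via w a∼w w∼b with middle w a∼w w∼b
      ...   | refl = uniqueMidpoint (monitors⇒≢ mon) a≁b a∼w w∼b middle

  megIs-n∸∣S∣ : ∀ {S : Subset n} → IsMEG G (∁ S) → (∀ M → IsMEG G M → ∁ M ⊆ S) → MegIs G (n ∸ ∣ S ∣)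
  megIs-n∸∣S∣ {S} meg minimal =
    (∁ S , meg , ∣∁p∣≡n∸∣p∣ S) ,
    λ M megM → subst (_≤ ∣ M ∣) (∣∁p∣≡n∸∣p∣ S) (p⊆q⇒∣p∣≤∣q∣ (∁q⊆p⇒∁p⊆q (minimal M megM)))

module Deletion {n : ℕ} (G : Graph n) (v : Fin n) where

  G-v : Graph n
  G-v = deleteVertex G v

  deleteVertex-adj⁻ : ∀ {p q} → Adj G-v p q → Adj G p q × p ≢ v × q ≢ v
  deleteVertex-adj⁻ {p} {q} _ with adj G p q | p ≟ v | q ≟ v
  ... | true | no p≢v | no q≢v = refl , p≢v , q≢v

  deleteVertex-adj⁺ : ∀ {p q} → Adj G p q → p ≢ v → q ≢ v → Adj G-v p q
  deleteVertex-adj⁺ {p} {q} p∼q p≢v q≢v with adj G p q | p ≟ v | q ≟ v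
  ... | true | no _    | no _    = refl
  ... | _    | yes p≡v | _       = ⊥-elim (p≢v p≡v)
  ... | _    | no _    | yes q≡v = ⊥-elim (q≢v q≡v)

  deleteVertex-isCograph : IsCograph G → IsCograph G-v
  deleteVertex-isCograph cograph
    (a , b , c , d , distinct , (a∼b , b∼c , c∼d) , (a≁c , a≁d , b≁d)) =
    cograph (a , b , c , d , distinct , (edge a∼b , edge b∼c , edge c∼d) ,
             (lift a≢v c≢v a≁c , lift a≢v d≢v a≁d , lift b≢v d≢v b≁d))
    where
      edge : ∀ {p q} → Adj G-v p q → Adj G p q
      edge = proj₁ ∘ deleteVertex-adj⁻
      lift : ∀ {p q} → p ≢ v → q ≢ v → ¬ Adj G-v p q → ¬ Adj G p q
      lift p≢v q≢v p≁q p∼q = p≁q (deleteVertex-adj⁺ p∼q p≢v q≢v)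
      a≢v = proj₁ (proj₂ (deleteVertex-adj⁻ a∼b))
      b≢v = proj₁ (proj₂ (deleteVertex-adj⁻ b∼c))
      c≢v = proj₁ (proj₂ (deleteVertex-adj⁻ c∼d))
      d≢v = proj₂ (proj₂ (deleteVertex-adj⁻ c∼d))

  open GraphBasics G
  open Monitoring G

  ¬uniqueMidpoint⇒reachable : ∀ {p q} → Adj G p v → Adj G v q → ¬ UniqueMidpoint v p q →
                              Reachable G-v p q
  ¬uniqueMidpoint⇒reachable {p} {q} p∼v v∼q ¬m = reach (adj⇒≢ p∼v) (≢-sym (adj⇒≢ v∼q))
    where
      reach : p ≢ v → q ≢ v → Reachable G-v p q
      reach p≢v q≢v with p ≟ q | adj? p q | any? (λ w → ¬? (w ≟ v) ×-dec adj? p w ×-dec adj? w q)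
      ... | yes refl | _       | _ = 0 , here
      ... | no _     | yes p∼q | _ = 1 , step (deleteVertex-adj⁺ p∼q p≢v q≢v) here
      ... | no _     | no _    | yes (w , w≢v , p∼w , w∼q) =
        2 , step (deleteVertex-adj⁺ p∼w p≢v w≢v) (step (deleteVertex-adj⁺ w∼q w≢v q≢v) here)
      ... | no p≢q   | no p≁q  | no ∄w =
        ⊥-elim (¬m (uniqueMidpoint p≢q p≁q p∼v v∼q
          λ w p∼w w∼q → decidable-stable (w ≟ v) λ w≢v → ∄w (w , w≢v , p∼w , w∼q)))

module Cograph {n : ℕ} (G : Graph n) (cograph : IsCograph G) where
  open GraphBasics G
  open Monitoring G

  module _ {v : Fin n} where
    open Deletion G v

    uniqueMidpoint-separates : ∀ {a b} → UniqueMidpoint v a b → ¬ Reachable G-v a b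
    uniqueMidpoint-separates m (_ , p)
      with GraphBasics.walk⇒dist≤2 G-v (deleteVertex-isCograph cograph) p
    ... | same a≡b     = distinct m a≡b
    ... | adjacent a∼b = nonadjacent m (proj₁ (deleteVertex-adj⁻ a∼b))
    ... | via w a∼w w∼b = let (a∼w′ , _ , w≢v) = deleteVertex-adj⁻ a∼w in
      w≢v (unique m w a∼w′ (proj₁ (deleteVertex-adj⁻ w∼b)))

    -- Otherwise a–y and y–b would both be joined avoiding v, hence so would a–b.
    uniqueMidpoint-partner : ∀ {a b y} → UniqueMidpoint v a b → Adj G v y →
                             ∃ λ t → UniqueMidpoint v t y
    uniqueMidpoint-partner {a} {b} {y} m v∼y with uniqueMidpoint? v a y | uniqueMidpoint? v y b
    ... | yes m₁ | _      = a , m₁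
    ... | no _   | yes m₂ = b , uniqueMidpoint-sym m₂
    ... | no ¬m₁ | no ¬m₂ = ⊥-elim (uniqueMidpoint-separates m
      (reachable-trans (¬uniqueMidpoint⇒reachable (edgeˡ m) v∼y ¬m₁)
                       (¬uniqueMidpoint⇒reachable (adj-sym v∼y) (edgeʳ m) ¬m₂)))

    -- Otherwise z–b–v–a is an induced P4.
    adj-end⇒adj-midpoint : ∀ {a b z} → UniqueMidpoint v a b → z ≢ v → Adj G z b → Adj G z v
    adj-end⇒adj-midpoint m z≢v z∼b = decidable-stable (adj? _ v) λ z≁v →
      cograph (inducedP4 z∼b (adj-sym (edgeʳ m)) (adj-sym (edgeˡ m)) z≁v
                         (λ z∼a → z≢v (unique m _ (adj-sym z∼a) z∼b))
                         (nonadjacent m ∘ adj-sym) z≢v (≢-sym (distinct m)))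

    -- Otherwise z–y–v–b is an induced P4.
    common-neighbour⇒adj-end : ∀ {a b y z} → UniqueMidpoint v a b → z ≢ v → ¬ Adj G z v →
                               Adj G z y → Adj G y v → Adj G y b
    common-neighbour⇒adj-end {z = z} m z≢v z≁v z∼y y∼v = decidable-stable (adj? _ _) λ y≁b →
      cograph (inducedP4 z∼y y∼v (edgeʳ m) z≁v z≁b y≁b z≢v (λ y≡b → z≁b (subst (Adj G z) y≡b z∼y)))
      where
        z≁b = z≁v ∘ adj-end⇒adj-midpoint m z≢v

module ConnectedCograph {n : ℕ} (G : Graph n) (connected : Connected G) (cograph : IsCograph G)
  where
  open GraphBasics G
  open Monitoring G
  open Cograph G cograph

  diameter≤2 : ∀ u v → Dist≤2 G u v
  diameter≤2 u v = walk⇒dist≤2 cograph (proj₂ (connected u v))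

  uniqueMidpoint⇒isCutVertex : ∀ {v a b} → UniqueMidpoint v a b → IsCutVertex G v
  uniqueMidpoint⇒isCutVertex {a = a} {b} m =
    a , b , adj⇒≢ (edgeˡ m) , ≢-sym (adj⇒≢ (edgeʳ m)) , connected a b , uniqueMidpoint-separates m

  uniqueMidpoint-universal : ∀ {v a b} → UniqueMidpoint v a b → ∀ z → z ≢ v → Adj G z v
  uniqueMidpoint-universal {v} m z z≢v =
    decidable-stable (adj? z v) λ z≁v → at-distance-2 z≁v (diameter≤2 z v)
    where
      at-distance-2 : ¬ Adj G z v → ¬ Dist≤2 G z v
      at-distance-2 _   (same z≡v)     = z≢v z≡v
      at-distance-2 z≁v (adjacent z∼v) = z≁v z∼v
      at-distance-2 z≁v (via y z∼y y∼v) = adj⇒≢ y∼v (unique m y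
        (adj-sym (common-neighbour⇒adj-end (uniqueMidpoint-sym m) z≢v z≁v z∼y y∼v))
        (common-neighbour⇒adj-end m z≢v z≁v z∼y y∼v))

  ∁MEG⊆uniqueMidpoints : 2 ≤ n → ∀ {M u} → IsMEG G M → u ∈ ∁ M → IsUniqueMidpoint u
  ∁MEG⊆uniqueMidpoints 2≤n {u = u} meg u∈∁M =
    let (x , x≢u) = ∃-other 2≤n u in
    ∉MEG⇒isUniqueMidpoint diameter≤2 meg (x∈∁p⇒x∉p u∈∁M)
      (proj₂ (walk⇒neighbour (proj₂ (connected u x)) (≢-sym x≢u)))

  megIs-n∸1 : 2 ≤ n → ∀ {v a b} → UniqueMidpoint v a b → MegIs G (n ∸ 1)
  megIs-n∸1 2≤n {v} m = subst (MegIs G) (cong (n ∸_) (∣⁅x⁆∣≡1 v))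
    (megIs-n∸∣S∣ (∁⁅v⁆-isMEG (uniqueMidpoint-partner m)) λ M meg u∈∁M →
      let (_ , _ , m′) = ∁MEG⊆uniqueMidpoints 2≤n meg u∈∁M in
      subst (_∈ ⁅ v ⁆) (sym (universal⇒only-midpoint (uniqueMidpoint-universal m) m′)) (x∈⁅x⁆ v))

  megIs-n : 2 ≤ n → (∀ v → ¬ IsUniqueMidpoint v) → MegIs G n
  megIs-n 2≤n none = subst (MegIs G) (cong (n ∸_) (∣⊥∣≡0 n))
    (megIs-n∸∣S∣ ∁∅-isMEG λ M meg u∈∁M → ⊥-elim (none _ (∁MEG⊆uniqueMidpoints 2≤n meg u∈∁M)))

mainTheorem9 : ∀ {n} (G : Graph n) → 2 ≤ n → Connected G → IsCograph G →
    (HasCutVertex G × MegIs G (n ∸ 1)) ⊎ MegIs G n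
mainTheorem9 {n} G 2≤n connected cograph =
  dichotomy (any? λ v → any? λ a → any? λ b → uniqueMidpoint? v a b)
  where
    open Monitoring G
    open ConnectedCograph G connected cograph

    dichotomy : Dec (∃ IsUniqueMidpoint) → (HasCutVertex G × MegIs G (n ∸ 1)) ⊎ MegIs G n
    dichotomy (yes (v , _ , _ , m)) = inj₁ ((v , uniqueMidpoint⇒isCutVertex m) , megIs-n∸1 2≤n m)
    dichotomy (no ∄m)               = inj₂ (megIs-n 2≤n λ v → ∄m ∘ (v ,_))
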